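{- For every integer $m$ with $0\le m\leq p^k-1$, the dimension of $\Omega^n_m$ over $\mathbb{Z}/p\mathbb{Z}$ is $\binom{m+n}{n}$.
   Context: Let $p$ be prime, $k,n\in\mathbb{N}$, $R=\mathbb{Z}/p^k\mathbb{Z}$ with representatives $\{0,\dots,p^k-1\}$, $[m]=\{0,\dots,m-1\}$. For $j\in[p^k]$, $\phi_j(x)=\binom{x}{j}\bmod p$ (representative of $x$, $\binom{a}{b}=0$ for $a<b$). For $\alpha\in[p^k]^n$, $\phi_\alpha(x)=\prod_{i=1}^n\phi_{\alpha_i}(x_i)$ and $|\alpha|=\sum_i\alpha_i$. $\Omega^n_m=\operatorname{span}_{\mathbb{Z}/p\mathbb{Z}}\{\phi_\alpha:\alpha\in[p^k]^n,|\alpha|\le m\}$, a space of functions $R^n\to\mathbb{Z}/p\mathbb{Z}$. -}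

module Defs where

open import Data.Nat as ℕ using (ℕ; zero; suc; _^_; _≤_)
open import Data.Nat.Combinatorics using (_C_)
open import Data.Fin using (Fin; toℕ)
import Data.Fin as Fin
open import Data.Integer as ℤ using (ℤ; +_)
open import Data.Integer.Divisibility using (_∣_)
open import Data.Product using (Σ; _×_)

sumℕ : ∀ {r} → (Fin r → ℕ) → ℕ
sumℕ {zero}  f = 0
sumℕ {suc r} f = f Fin.zero ℕ.+ sumℕ (λ i → f (Fin.suc i))

sumℤ : ∀ {r} → (Fin r → ℤ) → ℤ
sumℤ {zero}  f = + 0
sumℤ {suc r} f = f Fin.zero ℤ.+ sumℤ (λ i → f (Fin.suc i))

-- Congruence modulo p on ℤ: the field ℤ/pℤ is modelled by ℤ up to ≡ mod p.
infix 4 _≡[mod_]_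
_≡[mod_]_ : ℤ → ℕ → ℤ → Set
a ≡[mod p ] b = (+ p) ∣ (a ℤ.- b)

-- R = ℤ/p^kℤ with representatives {0,…,p^k-1}; points of R^n.
Point : ℕ → ℕ → ℕ → Set
Point p k n = Fin n → Fin (p ^ k)

-- Functions R^n → ℤ/pℤ (values are integers read modulo p).
Fun : ℕ → ℕ → ℕ → Set
Fun p k n = Point p k n → ℤ

MultiIndex : ℕ → ℕ → ℕ → Set
MultiIndex p k n = Fin n → Fin (p ^ k)

∣_∣ₘ : ∀ {p k n} → MultiIndex p k n → ℕ
∣_∣ₘ α = sumℕ (λ i → toℕ (α i))

φ : (p k : ℕ) → Fin (p ^ k) → Fin (p ^ k) → ℤ
φ p k j x = + (toℕ x C toℕ j)

prodℤ : ∀ {r} → (Fin r → ℤ) → ℤ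
prodℤ {zero}  f = + 1
prodℤ {suc r} f = f Fin.zero ℤ.* prodℤ (λ i → f (Fin.suc i))

φα : (p k n : ℕ) → MultiIndex p k n → Fun p k n
φα p k n α x = prodℤ (λ i → φ p k (α i) (x i))

InSpan : (p k n r : ℕ) → (Fin r → Fun p k n) → Fun p k n → Set
InSpan p k n r g f =
  Σ (Fin r → ℤ) λ c → ∀ x → f x ≡[mod p ] sumℤ (λ i → c i ℤ.* g i x)

Ω : (p k n m : ℕ) → Fun p k n → Set
Ω p k n m f =
  Σ ℕ λ r → Σ (Fin r → MultiIndex p k n) λ α →
    (∀ i → ∣_∣ₘ {p} {k} {n} (α i) ≤ m) × InSpan p k n r (λ i → φα p k n (α i)) f

LinIndep : (p k n d : ℕ) → (Fin d → Fun p k n) → Set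
LinIndep p k n d b =
  (c : Fin d → ℤ) → (∀ x → sumℤ (λ i → c i ℤ.* b i x) ≡[mod p ] (+ 0)) →
  ∀ i → c i ≡[mod p ] (+ 0)

HasDim : (p k n : ℕ) → (Fun p k n → Set) → ℕ → Set
HasDim p k n V d =
  Σ (Fin d → Fun p k n) λ b →
    (∀ i → V (b i)) × (∀ f → V f → InSpan p k n d b f) × LinIndep p k n d b

-- The functions φ_α with |α| ≤ m form a basis of Ω^n_m. As m < p^k, every such α is a genuine
-- element of [p^k]^n, and these multi-indices are counted by Pascal's rule, giving (m+n) C n
-- of them. Evaluating at the point β gives
-- φ_α(β) = ∏ (β_t C α_t), which is 1 for α = β and 0 unless α ≤ β coordinatewise; ordered by
-- |α| the evaluation matrix is unitriangular, so the φ_α are independent modulo any integer.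
module Submission where

open import Defs
open import Data.Nat using (ℕ; zero; suc; _+_; _^_; _∸_; _≤_; _<_; s≤s; s≤s⁻¹; z≤n; NonZero)
open import Data.Nat.Properties
  using (≤-reflexive; ≤-antisym; ≤-trans; ≤-<-trans; <⇒≤; +-mono-<-≤; +-mono-≤-<;
         m≤m+n; m≤n+m; +-suc; +-comm; <-cmp; suc-injective; 0≢1+n; m^n≢0;
         m≤pred[n]⇒suc[m]≤n)
open import Data.Nat.Induction using (<-wellFounded)
open import Data.Nat.Primality using (Prime; prime⇒nonZero)
open import Data.Nat.Combinatorics using (_C_; nCn≡1; k>n⇒nCk≡0; nCk+nC[k+1]≡[n+1]C[k+1])
open import Data.Nat.Divisibility using (_∣0)
open import Data.Fin using (Fin; zero; suc; toℕ; fromℕ<; splitAt; _↑ˡ_; _↑ʳ_; punchIn)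
open import Data.Fin.Properties using (toℕ-fromℕ<; splitAt⁻¹-↑ˡ; splitAt⁻¹-↑ʳ; punchInᵢ≢i)
open import Data.Integer as ℤ using (ℤ; +_; _*_)
import Data.Integer.Properties as ℤP
import Data.Integer.Divisibility as Unsigned
open import Data.Integer.Divisibility.Signed
  using (_∣_; ∣ᵤ⇒∣; ∣⇒∣ᵤ; ∣m∣n⇒∣m+n; ∣m+n∣m⇒∣n; ∣m⇒∣m*n; ∣n⇒∣m*n)
open import Algebra.Properties.Semiring.Sum ℤP.+-*-semiring
  using (sum; sum-cong-≗; sum-remove; sum-replicate-zero; ∑-comm; *-distribʳ-sum)
open import Data.Vec.Functional using (Vector; []; _∷_; head; tail; map; replicate; _++_)
open import Data.Vec.Functional.Properties using (lookup-++ˡ; lookup-++ʳ)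
open import Data.Vec.Functional.Relation.Unary.Any using (Any)
import Data.Vec.Functional.Relation.Unary.All.Properties as All
open import Data.Product using (Σ; ∃; _,_; proj₁; proj₂)
open import Data.Sum using (_⊎_; inj₁; inj₂)
open import Function using (_∘_; _on_)
open import Function.Definitions using (Injective)
open import Induction.WellFounded using (Acc; acc)
import Relation.Binary.Construct.On as On
open import Relation.Binary using (Rel; Symmetric; tri<; tri≈; tri>)
open import Relation.Binary.PropositionalEquality
open import Relation.Nullary using (¬_; contradiction)

sumℕ-cong : ∀ {n} {α β : Vector ℕ n} → α ≗ β → sumℕ α ≡ sumℕ β
sumℕ-cong {zero}  α≗β = refl
sumℕ-cong {suc n} α≗β = cong₂ _+_ (α≗β zero) (sumℕ-cong (α≗β ∘ suc))

≤-sumℕ : ∀ {n} (α : Vector ℕ n) t → α t ≤ sumℕ α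
≤-sumℕ α zero    = m≤m+n (α zero) _
≤-sumℕ α (suc t) = ≤-trans (≤-sumℕ (tail α) t) (m≤n+m _ (α zero))

exceeds⊎≗⊎sum< : ∀ {n} (α β : Vector ℕ n) →
  (∃ λ t → β t < α t) ⊎ α ≗ β ⊎ sumℕ α < sumℕ β
exceeds⊎≗⊎sum< {zero} α β = inj₂ (inj₁ λ ())
exceeds⊎≗⊎sum< {suc n} α β
  with <-cmp (α zero) (β zero) | exceeds⊎≗⊎sum< (tail α) (tail β)
... | tri> _ _ β₀<α₀ | _                 = inj₁ (zero , β₀<α₀)
... | _              | inj₁ (t , βₜ<αₜ)  = inj₁ (suc t , βₜ<αₜ)
... | tri≈ _ α₀≡β₀ _ | inj₂ (inj₁ tail≗) = inj₂ (inj₁ λ { zero → α₀≡β₀ ; (suc t) → tail≗ t })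
... | tri≈ _ α₀≡β₀ _ | inj₂ (inj₂ tail<) = inj₂ (inj₂ (+-mono-≤-< (≤-reflexive α₀≡β₀) tail<))
... | tri< α₀<β₀ _ _ | inj₂ (inj₁ tail≗) = inj₂ (inj₂ (+-mono-<-≤ α₀<β₀ (≤-reflexive (sumℕ-cong tail≗))))
... | tri< α₀<β₀ _ _ | inj₂ (inj₂ tail<) = inj₂ (inj₂ (+-mono-<-≤ α₀<β₀ (<⇒≤ tail<)))

++-injective : ∀ {a ℓ} {A : Set a} {_≈_ : Rel A ℓ} {m n} {xs : Vector A m} {ys : Vector A n} →
  Symmetric _≈_ → Injective _≡_ _≈_ xs → Injective _≡_ _≈_ ys →
  (∀ i j → ¬ xs i ≈ ys j) → Injective _≡_ _≈_ (xs ++ ys)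
++-injective {m = m} {n} ≈-sym xs-inj ys-inj disjoint {i} {j} eq
  with splitAt m i in i≡ | splitAt m j in j≡
... | inj₁ a | inj₁ b = trans (sym (splitAt⁻¹-↑ˡ i≡)) (trans (cong (_↑ˡ n) (xs-inj eq)) (splitAt⁻¹-↑ˡ j≡))
... | inj₂ a | inj₂ b = trans (sym (splitAt⁻¹-↑ʳ i≡)) (trans (cong (m ↑ʳ_) (ys-inj eq)) (splitAt⁻¹-↑ʳ j≡))
... | inj₁ a | inj₂ b = contradiction eq (disjoint a b)
... | inj₂ a | inj₁ b = contradiction (≈-sym eq) (disjoint b a)

Any-++⁺ˡ : ∀ {a ℓ} {A : Set a} {P : A → Set ℓ} {m n} {xs : Vector A m} (ys : Vector A n) →
  Any P xs → Any P (xs ++ ys)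
Any-++⁺ˡ {P = P} {xs = xs} ys (i , pxᵢ) = i ↑ˡ _ , subst P (sym (lookup-++ˡ xs ys i)) pxᵢ

Any-++⁺ʳ : ∀ {a ℓ} {A : Set a} {P : A → Set ℓ} {m n} (xs : Vector A m) {ys : Vector A n} →
  Any P ys → Any P (xs ++ ys)
Any-++⁺ʳ {P = P} {m} xs {ys} (j , pyⱼ) = m ↑ʳ j , subst P (sym (lookup-++ʳ xs ys j)) pyⱼ

record Enumerates {n N : ℕ} (P : Vector ℕ n → Set) (xs : Vector (Vector ℕ n) N) : Set where
  field
    sound     : ∀ i → P (xs i)
    complete  : ∀ α → P α → Any (_≗ α) xs
    injective : Injective _≡_ _≗_ xs

-- Pascal's rule: either α₀ > 0 (and lowering it leaves |α| ≤ m - 1) or α₀ = 0.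
#multiIndices≤ : ℕ → ℕ → ℕ
#multiIndices≤ zero    m       = 1
#multiIndices≤ (suc n) zero    = 1
#multiIndices≤ (suc n) (suc m) = #multiIndices≤ (suc n) m + #multiIndices≤ n (suc m)

raiseHead : ∀ {n} → Vector ℕ (suc n) → Vector ℕ (suc n)
raiseHead β = suc (head β) ∷ tail β

multiIndices≤ : ∀ n m → Vector (Vector ℕ n) (#multiIndices≤ n m)
multiIndices≤ zero    m       = λ _ → []
multiIndices≤ (suc n) zero    = λ _ → replicate (suc n) 0
multiIndices≤ (suc n) (suc m) =
  map raiseHead (multiIndices≤ (suc n) m) ++ map (0 ∷_) (multiIndices≤ n (suc m))

#multiIndices≤≡C : ∀ n m → #multiIndices≤ n m ≡ (m + n) C n
#multiIndices≤≡C zero    m       = refl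
#multiIndices≤≡C (suc n) zero    = sym (nCn≡1 (suc n))
#multiIndices≤≡C (suc n) (suc m) = begin
  #multiIndices≤ (suc n) m + #multiIndices≤ n (suc m)
    ≡⟨ cong₂ _+_ (#multiIndices≤≡C (suc n) m) (#multiIndices≤≡C n (suc m)) ⟩
  (m + suc n) C suc n + (suc m + n) C n
    ≡⟨ cong (λ l → (m + suc n) C suc n + l C n) (sym (+-suc m n)) ⟩
  (m + suc n) C suc n + (m + suc n) C n
    ≡⟨ +-comm ((m + suc n) C suc n) _ ⟩
  (m + suc n) C n + (m + suc n) C suc n
    ≡⟨ nCk+nC[k+1]≡[n+1]C[k+1] (m + suc n) n ⟩
  suc (m + suc n) C suc n ∎
  where open ≡-Reasoning

multiIndices≤-sound : ∀ n m i → sumℕ (multiIndices≤ n m i) ≤ m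
multiIndices≤-sound zero    m       i = z≤n
multiIndices≤-sound (suc n) zero    i = ≤-reflexive (sum-zeros n)
  where
  sum-zeros : ∀ n → sumℕ (replicate (suc n) 0) ≡ 0
  sum-zeros zero    = refl
  sum-zeros (suc n) = sum-zeros n
multiIndices≤-sound (suc n) (suc m) = All.++⁺ (λ β → sumℕ β ≤ suc m)
  (s≤s ∘ multiIndices≤-sound (suc n) m) (multiIndices≤-sound n (suc m))

multiIndices≤-complete : ∀ n m (α : Vector ℕ n) → sumℕ α ≤ m → Any (_≗ α) (multiIndices≤ n m)
multiIndices≤-complete zero    m       α _     = zero , λ ()
multiIndices≤-complete (suc n) zero    α |α|≤0 =
  zero , λ t → sym (≤-antisym (≤-trans (≤-sumℕ α t) |α|≤0) z≤n)
multiIndices≤-complete (suc n) (suc m) α |α|≤ with head α in α₀≡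
... | zero = Any-++⁺ʳ {P = _≗ α} (map raiseHead (multiIndices≤ (suc n) m)) (j , headZero≗α)
  where
  open Σ (multiIndices≤-complete n (suc m) (tail α) |α|≤) renaming (proj₁ to j; proj₂ to βⱼ≗tail)
  headZero≗α : (0 ∷ multiIndices≤ n (suc m) j) ≗ α
  headZero≗α zero    = sym α₀≡
  headZero≗α (suc t) = βⱼ≗tail t
... | suc a = Any-++⁺ˡ {P = _≗ α} (map (0 ∷_) (multiIndices≤ n (suc m))) (j , raised≗α)
  where
  open Σ (multiIndices≤-complete (suc n) m (a ∷ tail α) (s≤s⁻¹ |α|≤)) renaming (proj₁ to j; proj₂ to βⱼ≗)
  raised≗α : raiseHead (multiIndices≤ (suc n) m j) ≗ α
  raised≗α zero    = trans (cong suc (βⱼ≗ zero)) (sym α₀≡)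
  raised≗α (suc t) = βⱼ≗ (suc t)

multiIndices≤-injective : ∀ n m → Injective _≡_ _≗_ (multiIndices≤ n m)
multiIndices≤-injective zero    m       {zero} {zero} _ = refl
multiIndices≤-injective (suc n) zero    {zero} {zero} _ = refl
multiIndices≤-injective (suc n) (suc m) =
  ++-injective {_≈_ = _≗_} (λ f≗g → sym ∘ f≗g) raised-injective headZero-injective
    (λ i j raised≗headZero → 0≢1+n (sym (raised≗headZero zero)))
  where
  raised-injective : Injective _≡_ _≗_ (map raiseHead (multiIndices≤ (suc n) m))
  raised-injective eq = multiIndices≤-injective (suc n) m
    λ { zero → suc-injective (eq zero) ; (suc t) → eq (suc t) }
  headZero-injective : Injective _≡_ _≗_ (map (0 ∷_) (multiIndices≤ n (suc m)))
  headZero-injective eq = multiIndices≤-injective n (suc m) (eq ∘ suc)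

boundedMultiIndices : ∀ n m →
  Σ (Vector (Vector ℕ n) ((m + n) C n)) (Enumerates (λ α → sumℕ α ≤ m))
boundedMultiIndices n m =
  subst (λ N → Σ (Vector (Vector ℕ n) N) (Enumerates (λ α → sumℕ α ≤ m)))
    (#multiIndices≤≡C n m)
    (multiIndices≤ n m , record
      { sound     = multiIndices≤-sound n m
      ; complete  = multiIndices≤-complete n m
      ; injective = multiIndices≤-injective n m
      })

sumℤ≡sum : ∀ {r} (f : Vector ℤ r) → sumℤ f ≡ sum f
sumℤ≡sum {zero}  f = refl
sumℤ≡sum {suc r} f = cong (ℤ._+_ (f zero)) (sumℤ≡sum (tail f))

single : ∀ {d} → Fin d → ℤ → Vector ℤ d
single zero    v zero    = v
single zero    v (suc i) = + 0
single (suc a) v zero    = + 0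
single (suc a) v (suc i) = single a v i

sum-single-* : ∀ {d} (a : Fin d) v (B : Vector ℤ d) → sum (λ i → single a v i * B i) ≡ v * B a
sum-single-* {suc d} zero    v B = trans (cong (ℤ._+_ (v * B zero)) sum0*B≡0) (ℤP.+-identityʳ _)
  where
  sum0*B≡0 : sum (λ i → + 0 * B (suc i)) ≡ + 0
  sum0*B≡0 = trans (sum-cong-≗ (λ i → ℤP.*-zeroˡ (B (suc i)))) (sum-replicate-zero d)
sum-single-* (suc a) v B =
  trans (cong₂ ℤ._+_ (ℤP.*-zeroˡ (B zero)) (sum-single-* a v (tail B))) (ℤP.+-identityˡ _)

-- collect σ c i = Σ_{σ j = i} c j
collect : ∀ {r d} → (Fin r → Fin d) → Vector ℤ r → Vector ℤ d
collect σ c i = sum (λ j → single (σ j) (c j) i)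

sum-reindex : ∀ {r d} (σ : Fin r → Fin d) (c : Vector ℤ r) (B : Vector ℤ d) →
  sum (λ j → c j * B (σ j)) ≡ sum (λ i → collect σ c i * B i)
sum-reindex σ c B = begin
  sum (λ j → c j * B (σ j))
    ≡⟨ sum-cong-≗ (λ j → sym (sum-single-* (σ j) (c j) B)) ⟩
  sum (λ j → sum (λ i → single (σ j) (c j) i * B i))
    ≡⟨ ∑-comm (λ j i → single (σ j) (c j) i * B i) ⟩
  sum (λ i → sum (λ j → single (σ j) (c j) i * B i))
    ≡⟨ sum-cong-≗ (λ i → sym (*-distribʳ-sum (B i) (λ j → single (σ j) (c j) i))) ⟩
  sum (λ i → collect σ c i * B i) ∎
  where open ≡-Reasoning

InSpan-reindex : ∀ {p k n r d} {g : Fin r → Fun p k n} (b : Fin d → Fun p k n) (σ : Fin r → Fin d) →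
  (∀ j x → g j x ≡ b (σ j) x) → ∀ {f} → InSpan p k n r g f → InSpan p k n d b f
InSpan-reindex {p} {g = g} b σ g≡bσ {f} (c , f≡) = collect σ c , λ x →
  subst (λ s → f x ≡[mod p ] s) (combination≡ x) (f≡ x)
  where
  combination≡ : ∀ x → sumℤ (λ j → c j * g j x) ≡ sumℤ (λ i → collect σ c i * b i x)
  combination≡ x = begin
    sumℤ (λ j → c j * g j x)             ≡⟨ sumℤ≡sum (λ j → c j * g j x) ⟩
    sum (λ j → c j * g j x)              ≡⟨ sum-cong-≗ (λ j → cong (c j *_) (g≡bσ j x)) ⟩
    sum (λ j → c j * b (σ j) x)          ≡⟨ sum-reindex σ c (λ i → b i x) ⟩
    sum (λ i → collect σ c i * b i x)    ≡⟨ sumℤ≡sum (λ i → collect σ c i * b i x) ⟨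
    sumℤ (λ i → collect σ c i * b i x)   ∎
    where open ≡-Reasoning

InSpan-self : ∀ {p k n} (g : Fun p k n) → InSpan p k n 1 (λ _ → g) g
InSpan-self {p} g = (λ _ → + 1) , λ x →
  subst ((+ p) Unsigned.∣_) (sym (g-1*g x)) (p ∣0)
  where
  g-1*g : ∀ x → g x ℤ.- (+ 1 * g x ℤ.+ + 0) ≡ + 0
  g-1*g x = trans (cong (λ s → g x ℤ.- s) (trans (ℤP.+-identityʳ _) (ℤP.*-identityˡ _))) (ℤP.+-inverseʳ (g x))

prodℤ-cong : ∀ {r} {f g : Vector ℤ r} → f ≗ g → prodℤ f ≡ prodℤ g
prodℤ-cong {zero}  f≗g = refl
prodℤ-cong {suc r} f≗g = cong₂ _*_ (f≗g zero) (prodℤ-cong (f≗g ∘ suc))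

prodℤ-ones : ∀ {r} {f : Vector ℤ r} → (∀ t → f t ≡ + 1) → prodℤ f ≡ + 1
prodℤ-ones {zero}  f≡1 = refl
prodℤ-ones {suc r} f≡1 = cong₂ _*_ (f≡1 zero) (prodℤ-ones (f≡1 ∘ suc))

prodℤ-zero : ∀ {r} {f : Vector ℤ r} t → f t ≡ + 0 → prodℤ f ≡ + 0
prodℤ-zero {f = f} zero    f₀≡0 = cong (_* prodℤ (tail f)) f₀≡0
prodℤ-zero {f = f} (suc t) fₜ≡0 = trans (cong (f zero *_) (prodℤ-zero t fₜ≡0)) (ℤP.*-zeroʳ (f zero))

-- φα p k n α x is, by definition, binomialProduct (toℕ ∘ x) (toℕ ∘ α).
binomialProduct : ∀ {n} → Vector ℕ n → Vector ℕ n → ℤ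
binomialProduct β α = prodℤ (λ t → + (β t C α t))

binomialProduct-cong : ∀ {n} {β β′ α α′ : Vector ℕ n} → β ≗ β′ → α ≗ α′ →
  binomialProduct β α ≡ binomialProduct β′ α′
binomialProduct-cong β≗β′ α≗α′ = prodℤ-cong (λ t → cong₂ (λ b a → + (b C a)) (β≗β′ t) (α≗α′ t))

binomialProduct-diag : ∀ {n} (α : Vector ℕ n) → binomialProduct α α ≡ + 1
binomialProduct-diag α = prodℤ-ones (λ t → cong +_ (nCn≡1 (α t)))

binomialProduct-exceeds : ∀ {n} {β α : Vector ℕ n} t → β t < α t → binomialProduct β α ≡ + 0
binomialProduct-exceeds t βₜ<αₜ = prodℤ-zero t (cong +_ (k>n⇒nCk≡0 βₜ<αₜ))

≡[mod]0⇒∣ : ∀ {p a} → a ≡[mod p ] + 0 → (+ p) ∣ a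
≡[mod]0⇒∣ {p} {a} p∣a-0 = ∣ᵤ⇒∣ (subst ((+ p) Unsigned.∣_) (ℤP.+-identityʳ a) p∣a-0)

∣⇒≡[mod]0 : ∀ {p a} → (+ p) ∣ a → a ≡[mod p ] + 0
∣⇒≡[mod]0 {p} {a} p∣a = subst ((+ p) Unsigned.∣_) (sym (ℤP.+-identityʳ a)) (∣⇒∣ᵤ p∣a)

∣-sum : ∀ {r q} (g : Vector ℤ r) → (∀ j → q ∣ g j) → q ∣ sum g
∣-sum {zero}  g q∣g = ∣ᵤ⇒∣ (_ ∣0)
∣-sum {suc r} g q∣g = ∣m∣n⇒∣m+n (q∣g zero) (∣-sum (tail g) (q∣g ∘ suc))

∣sum∧∣rest⇒∣ : ∀ {r q} (g : Vector ℤ r) i → (∀ j → j ≢ i → q ∣ g j) → q ∣ sum g → q ∣ g i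
∣sum∧∣rest⇒∣ {suc r} {q} g i q∣rest q∣sum = ∣m+n∣m⇒∣n q∣rest+gᵢ q∣sum-rest
  where
  q∣sum-rest : q ∣ sum (λ j → g (punchIn i j))
  q∣sum-rest = ∣-sum _ (λ j → q∣rest (punchIn i j) (punchInᵢ≢i i j))
  q∣rest+gᵢ : q ∣ sum (λ j → g (punchIn i j)) ℤ.+ g i
  q∣rest+gᵢ = subst (q ∣_) (trans (sum-remove {i = i} g) (ℤP.+-comm (g i) _)) q∣sum

triangular⇒LinIndep : ∀ {p k n d} (b : Fin d → Fun p k n) (x : Fin d → Point p k n) (w : Fin d → ℕ) →
  (∀ i → b i (x i) ≡ + 1) →
  (∀ i j → j ≢ i → b j (x i) ≡ + 0 ⊎ w j < w i) →
  LinIndep p k n d b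
triangular⇒LinIndep {p} {d = d} b x w diag offdiag c vanishes i =
  ∣⇒≡[mod]0 (p∣c i (On.wellFounded w <-wellFounded i))
  where
  p∣c : ∀ i → Acc (_<_ on w) i → (+ p) ∣ c i
  p∣c i (acc below) = subst ((+ p) ∣_) cᵢbᵢ≡cᵢ (∣sum∧∣rest⇒∣ terms i p∣rest p∣sum)
    where
    terms : Vector ℤ d
    terms j = c j * b j (x i)
    cᵢbᵢ≡cᵢ : terms i ≡ c i
    cᵢbᵢ≡cᵢ = trans (cong (c i *_) (diag i)) (ℤP.*-identityʳ (c i))
    p∣sum : (+ p) ∣ sum terms
    p∣sum = subst ((+ p) ∣_) (sumℤ≡sum terms) (≡[mod]0⇒∣ (vanishes (x i)))
    p∣rest : ∀ j → j ≢ i → (+ p) ∣ terms j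
    p∣rest j j≢i with offdiag i j j≢i
    ... | inj₁ bⱼ≡0  = ∣n⇒∣m*n (c j) (subst ((+ p) ∣_) (sym bⱼ≡0) (∣ᵤ⇒∣ (p ∣0)))
    ... | inj₂ wⱼ<wᵢ = ∣m⇒∣m*n (b j (x i)) (p∣c j (below wⱼ<wᵢ))

module φBasis (p k n m : ℕ) (m<p^k : m < p ^ k) where

  d : ℕ
  d = (m + n) C n

  α : Vector (Vector ℕ n) d
  α = proj₁ (boundedMultiIndices n m)

  open Enumerates (proj₂ (boundedMultiIndices n m))

  toMultiIndex : (β : Vector ℕ n) → sumℕ β ≤ m → MultiIndex p k n
  toMultiIndex β |β|≤m t = fromℕ< (≤-<-trans (≤-trans (≤-sumℕ β t) |β|≤m) m<p^k)

  index : Fin d → MultiIndex p k n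
  index i = toMultiIndex (α i) (sound i)

  toℕ-index : ∀ i → toℕ ∘ index i ≗ α i
  toℕ-index i t = toℕ-fromℕ< _

  basis : Fin d → Fun p k n
  basis i = φα p k n (index i)

  basis∈Ω : ∀ i → Ω p k n m (basis i)
  basis∈Ω i = 1 , (λ _ → index i) , (λ _ → |index|≤m) , InSpan-self {p} {k} {n} (basis i)
    where
    |index|≤m : ∣_∣ₘ {p} {k} {n} (index i) ≤ m
    |index|≤m = subst (_≤ m) (sym (sumℕ-cong (toℕ-index i))) (sound i)

  Ω⊆span : ∀ f → Ω p k n m f → InSpan p k n d basis f
  Ω⊆span f (r , β , |β|≤m , f∈span) = InSpan-reindex {p} {k} {n} basis σ φβ≡basisσ {f} f∈span
    where
    β∈α : ∀ j → ∃ λ i → α i ≗ toℕ ∘ β j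
    β∈α j = complete (toℕ ∘ β j) (|β|≤m j)
    σ : Fin r → Fin d
    σ j = proj₁ (β∈α j)
    φβ≡basisσ : ∀ j x → φα p k n (β j) x ≡ basis (σ j) x
    φβ≡basisσ j x = binomialProduct-cong (λ _ → refl)
      (λ t → sym (trans (toℕ-index (σ j) t) (proj₂ (β∈α j) t)))

  basis-independent : LinIndep p k n d basis
  basis-independent = triangular⇒LinIndep {p} {k} {n} basis index (sumℕ ∘ α) diag offdiag
    where
    diag : ∀ i → basis i (index i) ≡ + 1
    diag i = binomialProduct-diag (toℕ ∘ index i)
    offdiag : ∀ i j → j ≢ i → basis j (index i) ≡ + 0 ⊎ sumℕ (α j) < sumℕ (α i)
    offdiag i j j≢i with exceeds⊎≗⊎sum< (α j) (α i)
    ... | inj₁ (t , αᵢₜ<αⱼₜ) = inj₁ (trans (binomialProduct-cong (toℕ-index i) (toℕ-index j))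
                                          (binomialProduct-exceeds {β = α i} {α = α j} t αᵢₜ<αⱼₜ))
    ... | inj₂ (inj₁ αⱼ≗αᵢ)  = contradiction (injective αⱼ≗αᵢ) j≢i
    ... | inj₂ (inj₂ |αⱼ|<|αᵢ|) = inj₂ |αⱼ|<|αᵢ|

  hasDim : HasDim p k n (Ω p k n m) d
  hasDim = basis , basis∈Ω , Ω⊆span , basis-independent

corollary5p2 : (p k n m : ℕ) → Prime p → m ≤ p ^ k ∸ 1 →
    HasDim p k n (Ω p k n m) ((m + n) C n)
corollary5p2 p k n m p-prime m≤p^k∸1 = φBasis.hasDim p k n m m<p^k
  where
  -- Primality is only needed for p^k ≠ 0: otherwise m ≤ p^k ∸ 1 = 0 would not give m < p^k.
  instance
    p^k≢0 : NonZero (p ^ k)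
    p^k≢0 = m^n≢0 p k {{prime⇒nonZero p-prime}}
  m<p^k : m < p ^ k
  m<p^k = m≤pred[n]⇒suc[m]≤n m≤p^k∸1
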